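{- Let $q\neq0$ be an odd integer. Let $u_1,\dots,u_k$, $v_1,\dots,v_k$ (with all $v_i\neq 0$) and $\ell_1,\dots,\ell_k$ be integers such that $u_1v_i=u_iv_1+q\ell_i$ and $(4u_iv_i,q)=1$ for all $1\le i\le k$. Then $$\sum_{i\le k}\frac{\overline q^2u_i^2}{4v_i}\equiv-\frac{u_1\overline{4v_1}\sum_{1\le i\le k}u_i}{q^2}+\frac{u_1\overline{4v_1^2}\sum_{1\le i\le k}\ell_i}{q}+\sum_{i\le k}\frac{u_i^2}{4v_iq^2}\pmod 1.$$
   Context: In the $i$-th term on the left, $\overline q$ denotes the multiplicative inverse of $q$ modulo $4v_i$; $\overline{4v_1}$ denotes the inverse of $4v_1$ modulo $q^2$; $\overline{4v_1^2}$ denotes the inverse of $4v_1^2$ modulo $q$. The congruence is an equality of rational numbers modulo $\mathbb{Z}$. -}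

module Defs where

open import Data.Nat using (ℕ; zero; suc)
open import Data.Fin using (Fin; zero; suc)
open import Data.Integer as ℤ using (ℤ; +_; +[1+_]; -[1+_])
open import Data.Rational as ℚ using (ℚ; _/_)
open import Data.Product using (∃)
open import Relation.Binary.PropositionalEquality using (_≡_)

-- the rational number a / b for integers a, b (with b ≠ 0; value 0 if b = 0,
-- a case never used in the statement since all denominators are nonzero there)
frac : ℤ → ℤ → ℚ
frac a (+ zero)    = ℚ.0ℚ
frac a +[1+ n ]    = a / suc n
frac a -[1+ n ]    = (ℤ.- a) / suc n

sumℤ : ∀ {n} → (Fin n → ℤ) → ℤ
sumℤ {zero}  f = ℤ.0ℤ
sumℤ {suc n} f = f zero ℤ.+ sumℤ (λ i → f (suc i))

sumℚ : ∀ {n} → (Fin n → ℚ) → ℚ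
sumℚ {zero}  f = ℚ.0ℚ
sumℚ {suc n} f = f zero ℚ.+ sumℚ (λ i → f (suc i))

_≡ℚ[mod1]_ : ℚ → ℚ → Set
x ≡ℚ[mod1] y = ∃ λ (z : ℤ) → x ℚ.- y ≡ z / 1

{-# OPTIONS --safe #-}
-- Each summand is treated separately. Over the common denominator 4vᵢq² the
-- difference between the i-th term on the left and the i-th terms on the right
-- has numerator  N = q̄²uᵢ²q² + 4vᵢu₁auᵢ − 4vᵢu₁bℓᵢq − uᵢ², so it suffices that
-- 4vᵢ ∣ N and q² ∣ N, these moduli being coprime as q is invertible mod 4vᵢ.
-- Modulo 4vᵢ this is qq̄ ≡ 1. Modulo q², using 4v₁a ≡ 1 and u₁vᵢ = uᵢv₁ + qℓᵢ,
-- N ≡ 4qℓᵢ(auᵢ − u₁bvᵢ), and auᵢ ≡ u₁bvᵢ (mod q) since both are uᵢ/(4v₁) mod q.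
module Submission where

open import Defs
open import Data.Nat using (ℕ)
open import Data.Fin using (Fin; zero)
open import Data.Integer using (ℤ; +_; _+_; _-_; _*_; -_; 0ℤ; 1ℤ)
open import Data.Integer.Divisibility using (_∣_)
open import Data.Integer.GCD using (gcd)
open import Data.Rational using (ℚ) renaming (_+_ to _+ℚ_; -_ to -ℚ_)
open import Relation.Binary.PropositionalEquality using (_≡_; _≢_)
open import Relation.Nullary using (¬_)
open import Relation.Nullary.Negation using (contradiction)

open import Level using (0ℓ)
open import Data.Maybe using (nothing)
open import Data.Product using (_,_)
open import Data.Sum using ([_,_])
open import Function using (_∘_)
open import Data.Fin using (suc)
open import Data.Integer using (+[1+_]; -[1+_])
import Data.Nat as ℕ
import Data.Nat.Properties as ℕP
import Data.Integer.Properties as ℤP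
open import Data.Integer.Divisibility.Signed
  using (divides; ∣ᵤ⇒∣; ∣-trans; ∣m∣n⇒∣m+n; ∣m∣n⇒∣m-n; ∣n⇒∣m*n; *-monoˡ-∣)
  renaming (_∣_ to _∣ₛ_)
open import Data.Integer.Tactic.RingSolver using (solve-∀)
open import Data.Rational using (_/_; 0ℚ; 1ℚ; toℚᵘ; fromℚᵘ)
  renaming (_*_ to _*ℚ_; _-_ to _-ℚ_)
import Data.Rational.Properties as ℚP
open import Data.Rational.Unnormalised as ℚᵘ using (mkℚᵘ; *≡*)
import Data.Rational.Unnormalised.Properties as ℚᵘP
open import Relation.Binary.PropositionalEquality
  using (refl; sym; trans; cong; cong₂; subst; module ≡-Reasoning)
import Tactic.RingSolver.Core.AlmostCommutativeRing as ACR
import Tactic.RingSolver as RingSolver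

ℚ-ring : ACR.AlmostCommutativeRing 0ℓ 0ℓ
ℚ-ring = ACR.fromCommutativeRing ℚP.+-*-commutativeRing (λ _ → nothing)

*-≢0 : ∀ {i j} → i ≢ 0ℤ → j ≢ 0ℤ → i * j ≢ 0ℤ
*-≢0 i≢0 j≢0 = [ i≢0 , j≢0 ] ∘ ℤP.i*j≡0⇒i≡0∨j≡0 _

fromℤ : ℤ → ℚ
fromℤ z = z / 1

module _ where
  open ℚᵘP.≃-Reasoning

  fromℚᵘ-homo-+ : ∀ x y → fromℚᵘ (x ℚᵘ.+ y) ≡ fromℚᵘ x +ℚ fromℚᵘ y
  fromℚᵘ-homo-+ x y = ℚP.toℚᵘ-injective (begin
    toℚᵘ (fromℚᵘ (x ℚᵘ.+ y))              ≈⟨ ℚP.toℚᵘ-fromℚᵘ (x ℚᵘ.+ y) ⟩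
    x ℚᵘ.+ y                               ≈⟨ ℚᵘP.+-cong (ℚP.toℚᵘ-fromℚᵘ x) (ℚP.toℚᵘ-fromℚᵘ y) ⟨
    toℚᵘ (fromℚᵘ x) ℚᵘ.+ toℚᵘ (fromℚᵘ y)   ≈⟨ ℚP.toℚᵘ-homo-+ (fromℚᵘ x) (fromℚᵘ y) ⟨
    toℚᵘ (fromℚᵘ x +ℚ fromℚᵘ y)            ∎)

  fromℚᵘ-homo-* : ∀ x y → fromℚᵘ (x ℚᵘ.* y) ≡ fromℚᵘ x *ℚ fromℚᵘ y
  fromℚᵘ-homo-* x y = ℚP.toℚᵘ-injective (begin
    toℚᵘ (fromℚᵘ (x ℚᵘ.* y))              ≈⟨ ℚP.toℚᵘ-fromℚᵘ (x ℚᵘ.* y) ⟩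
    x ℚᵘ.* y                               ≈⟨ ℚᵘP.*-cong (ℚP.toℚᵘ-fromℚᵘ x) (ℚP.toℚᵘ-fromℚᵘ y) ⟨
    toℚᵘ (fromℚᵘ x) ℚᵘ.* toℚᵘ (fromℚᵘ y)   ≈⟨ ℚP.toℚᵘ-homo-* (fromℚᵘ x) (fromℚᵘ y) ⟨
    toℚᵘ (fromℚᵘ x *ℚ fromℚᵘ y)            ∎)

  fromℚᵘ-homo‿- : ∀ x → fromℚᵘ (ℚᵘ.- x) ≡ -ℚ fromℚᵘ x
  fromℚᵘ-homo‿- x = ℚP.toℚᵘ-injective (begin
    toℚᵘ (fromℚᵘ (ℚᵘ.- x))   ≈⟨ ℚP.toℚᵘ-fromℚᵘ (ℚᵘ.- x) ⟩
    ℚᵘ.- x                   ≈⟨ ℚᵘP.-‿cong (ℚP.toℚᵘ-fromℚᵘ x) ⟨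
    ℚᵘ.- toℚᵘ (fromℚᵘ x)     ≈⟨ ℚP.toℚᵘ-homo‿- (fromℚᵘ x) ⟨
    toℚᵘ (-ℚ fromℚᵘ x)       ∎)

fromℤ-homo-+ : ∀ a b → fromℤ (a + b) ≡ fromℤ a +ℚ fromℤ b
fromℤ-homo-+ a b =
  trans (ℚP.fromℚᵘ-cong {mkℚᵘ (a + b) 0} {mkℚᵘ a 0 ℚᵘ.+ mkℚᵘ b 0} (*≡* (identity a b)))
        (fromℚᵘ-homo-+ (mkℚᵘ a 0) (mkℚᵘ b 0))
  where
  identity : ∀ a b → (a + b) * 1ℤ ≡ (a * 1ℤ + b * 1ℤ) * 1ℤ
  identity = solve-∀

fromℤ-homo-* : ∀ a b → fromℤ (a * b) ≡ fromℤ a *ℚ fromℤ b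
fromℤ-homo-* a b = fromℚᵘ-homo-* (mkℚᵘ a 0) (mkℚᵘ b 0)

fromℤ-homo‿- : ∀ a → fromℤ (- a) ≡ -ℚ fromℤ a
fromℤ-homo‿- a = fromℚᵘ-homo‿- (mkℚᵘ a 0)

fromℤ-homo-minus : ∀ a b → fromℤ (a - b) ≡ fromℤ a -ℚ fromℤ b
fromℤ-homo-minus a b = trans (fromℤ-homo-+ a (- b)) (cong (fromℤ a +ℚ_) (fromℤ-homo‿- b))

frac≡fromℤ*frac1 : ∀ a d → frac a d ≡ fromℤ a *ℚ frac 1ℤ d
frac≡fromℤ*frac1 a (+ 0)    = sym (ℚP.*-zeroʳ (fromℤ a))
frac≡fromℤ*frac1 a +[1+ n ] =
  trans (ℚP.fromℚᵘ-cong {mkℚᵘ a n} {mkℚᵘ a 0 ℚᵘ.* mkℚᵘ 1ℤ n} (*≡* cross-mult))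
        (fromℚᵘ-homo-* (mkℚᵘ a 0) (mkℚᵘ 1ℤ n))
  where
  cross-mult : a * +[1+ n ℕ.+ 0 ] ≡ (a * 1ℤ) * +[1+ n ]
  cross-mult rewrite ℕP.+-identityʳ n | ℤP.*-identityʳ a = refl
frac≡fromℤ*frac1 a -[1+ n ] =
  trans (ℚP.fromℚᵘ-cong {mkℚᵘ (- a) n} {mkℚᵘ a 0 ℚᵘ.* mkℚᵘ (- 1ℤ) n} (*≡* cross-mult))
        (fromℚᵘ-homo-* (mkℚᵘ a 0) (mkℚᵘ (- 1ℤ) n))
  where
  identity : ∀ a x → (- a) * x ≡ (a * - 1ℤ) * x
  identity = solve-∀
  cross-mult : (- a) * +[1+ n ℕ.+ 0 ] ≡ (a * - 1ℤ) * +[1+ n ]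
  cross-mult rewrite ℕP.+-identityʳ n = identity a +[1+ n ]

frac1-inverseʳ : ∀ {d} → d ≢ 0ℤ → fromℤ d *ℚ frac 1ℤ d ≡ 1ℚ
frac1-inverseʳ {+ 0} d≢0 = contradiction refl d≢0
frac1-inverseʳ {+[1+ n ]} _ =
  trans (sym (fromℚᵘ-homo-* (mkℚᵘ +[1+ n ] 0) (mkℚᵘ 1ℤ n)))
        (ℚP.fromℚᵘ-cong {mkℚᵘ +[1+ n ] 0 ℚᵘ.* mkℚᵘ 1ℤ n} {mkℚᵘ 1ℤ 0} (*≡* cross-mult))
  where
  identity : ∀ x → (x * 1ℤ) * 1ℤ ≡ 1ℤ * x
  identity = solve-∀
  cross-mult : (+[1+ n ] * 1ℤ) * 1ℤ ≡ 1ℤ * +[1+ n ℕ.+ 0 ]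
  cross-mult rewrite ℕP.+-identityʳ n = identity +[1+ n ]
frac1-inverseʳ { -[1+ n ] } _ =
  trans (sym (fromℚᵘ-homo-* (mkℚᵘ -[1+ n ] 0) (mkℚᵘ (- 1ℤ) n)))
        (ℚP.fromℚᵘ-cong {mkℚᵘ -[1+ n ] 0 ℚᵘ.* mkℚᵘ (- 1ℤ) n} {mkℚᵘ 1ℤ 0} (*≡* cross-mult))
  where
  identity : ∀ x → ((- x) * - 1ℤ) * 1ℤ ≡ 1ℤ * x
  identity = solve-∀
  cross-mult : (-[1+ n ] * - 1ℤ) * 1ℤ ≡ 1ℤ * +[1+ n ℕ.+ 0 ]
  cross-mult rewrite ℕP.+-identityʳ n = identity +[1+ n ]

frac-cancelʳ : ∀ a {d} → d ≢ 0ℤ → frac a d *ℚ fromℤ d ≡ fromℤ a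
frac-cancelʳ a {d} d≢0 = begin
  frac a d *ℚ fromℤ d                ≡⟨ cong (_*ℚ fromℤ d) (frac≡fromℤ*frac1 a d) ⟩
  fromℤ a *ℚ frac 1ℤ d *ℚ fromℤ d    ≡⟨ ℚP.*-assoc (fromℤ a) (frac 1ℤ d) (fromℤ d) ⟩
  fromℤ a *ℚ (frac 1ℤ d *ℚ fromℤ d)  ≡⟨ cong (fromℤ a *ℚ_) (trans (ℚP.*-comm (frac 1ℤ d) _) (frac1-inverseʳ d≢0)) ⟩
  fromℤ a *ℚ 1ℚ                      ≡⟨ ℚP.*-identityʳ (fromℤ a) ⟩
  fromℤ a                            ∎
  where open ≡-Reasoning

*-cancelʳ-fromℤ : ∀ {x y d} → d ≢ 0ℤ → x *ℚ fromℤ d ≡ y *ℚ fromℤ d → x ≡ y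
*-cancelʳ-fromℤ {x} {y} {d} d≢0 eq = begin
  x                              ≡⟨ undo x ⟩
  x *ℚ fromℤ d *ℚ frac 1ℤ d      ≡⟨ cong (_*ℚ frac 1ℤ d) eq ⟩
  y *ℚ fromℤ d *ℚ frac 1ℤ d      ≡⟨ undo y ⟨
  y                              ∎
  where
  open ≡-Reasoning
  undo : ∀ z → z ≡ z *ℚ fromℤ d *ℚ frac 1ℤ d
  undo z = sym (trans (ℚP.*-assoc z (fromℤ d) (frac 1ℤ d))
                      (trans (cong (z *ℚ_) (frac1-inverseʳ d≢0)) (ℚP.*-identityʳ z)))

frac-zero : ∀ d → frac 0ℤ d ≡ 0ℚ
frac-zero d = trans (frac≡fromℤ*frac1 0ℤ d) (ℚP.*-zeroˡ (frac 1ℤ d))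

frac-distrib-+ : ∀ a b d → frac (a + b) d ≡ frac a d +ℚ frac b d
frac-distrib-+ a b d
  rewrite frac≡fromℤ*frac1 (a + b) d | frac≡fromℤ*frac1 a d | frac≡fromℤ*frac1 b d
        | fromℤ-homo-+ a b = ℚP.*-distribʳ-+ (frac 1ℤ d) (fromℤ a) (fromℤ b)

≡mod1-by-clearing : ∀ {x y m n} → m ≢ 0ℤ → m ∣ₛ n → (x -ℚ y) *ℚ fromℤ m ≡ fromℤ n → x ≡ℚ[mod1] y
≡mod1-by-clearing {m = m} m≢0 (divides k refl) eq =
  k , *-cancelʳ-fromℤ m≢0 (trans eq (fromℤ-homo-* k m))

+-cong-mod1 : ∀ {x x′ y y′} → x ≡ℚ[mod1] x′ → y ≡ℚ[mod1] y′ → (x +ℚ y) ≡ℚ[mod1] (x′ +ℚ y′)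
+-cong-mod1 {x} {x′} {y} {y′} (m , x-x′≡m) (n , y-y′≡n) = m + n , (begin
  (x +ℚ y) -ℚ (x′ +ℚ y′)   ≡⟨ interchange x y x′ y′ ⟩
  (x -ℚ x′) +ℚ (y -ℚ y′)   ≡⟨ cong₂ _+ℚ_ x-x′≡m y-y′≡n ⟩
  fromℤ m +ℚ fromℤ n       ≡⟨ fromℤ-homo-+ m n ⟨
  fromℤ (m + n)            ∎)
  where
  open ≡-Reasoning
  interchange : ∀ a b c d → (a +ℚ b) -ℚ (c +ℚ d) ≡ (a -ℚ c) +ℚ (b -ℚ d)
  interchange = RingSolver.solve-∀ ℚ-ring

sumℚ-cong-mod1 : ∀ {n} (f g : Fin n → ℚ) → (∀ i → f i ≡ℚ[mod1] g i) → sumℚ f ≡ℚ[mod1] sumℚ g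
sumℚ-cong-mod1 {ℕ.zero}  f g _   = 0ℤ , refl
sumℚ-cong-mod1 {ℕ.suc n} f g f≡g =
  +-cong-mod1 {f zero} {g zero} (f≡g zero) (sumℚ-cong-mod1 (f ∘ suc) (g ∘ suc) (f≡g ∘ suc))

sumℚ-+ : ∀ {n} (f g : Fin n → ℚ) → sumℚ (λ i → f i +ℚ g i) ≡ sumℚ f +ℚ sumℚ g
sumℚ-+ {ℕ.zero}  f g = refl
sumℚ-+ {ℕ.suc n} f g =
  trans (cong ((f zero +ℚ g zero) +ℚ_) (sumℚ-+ (f ∘ suc) (g ∘ suc)))
        (interchange (f zero) (g zero) (sumℚ (f ∘ suc)) (sumℚ (g ∘ suc)))
  where
  interchange : ∀ a b c d → (a +ℚ b) +ℚ (c +ℚ d) ≡ (a +ℚ c) +ℚ (b +ℚ d)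
  interchange = RingSolver.solve-∀ ℚ-ring

sumℚ-neg : ∀ {n} (f : Fin n → ℚ) → sumℚ (λ i → -ℚ f i) ≡ -ℚ sumℚ f
sumℚ-neg {ℕ.zero}  f = refl
sumℚ-neg {ℕ.suc n} f =
  trans (cong (-ℚ f zero +ℚ_) (sumℚ-neg (f ∘ suc))) (sym (ℚP.neg-distrib-+ (f zero) (sumℚ (f ∘ suc))))

sumℚ-frac : ∀ {n} c (f : Fin n → ℤ) d → sumℚ (λ i → frac (c * f i) d) ≡ frac (c * sumℤ f) d
sumℚ-frac {ℕ.zero}  c f d = sym (trans (cong (λ t → frac t d) (ℤP.*-zeroʳ c)) (frac-zero d))
sumℚ-frac {ℕ.suc n} c f d = begin
  frac (c * f zero) d +ℚ sumℚ (λ i → frac (c * f (suc i)) d)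
    ≡⟨ cong (frac (c * f zero) d +ℚ_) (sumℚ-frac c (f ∘ suc) d) ⟩
  frac (c * f zero) d +ℚ frac (c * sumℤ (f ∘ suc)) d
    ≡⟨ frac-distrib-+ (c * f zero) (c * sumℤ (f ∘ suc)) d ⟨
  frac (c * f zero + c * sumℤ (f ∘ suc)) d
    ≡⟨ cong (λ t → frac t d) (ℤP.*-distribˡ-+ c (f zero) (sumℤ (f ∘ suc))) ⟨
  frac (c * sumℤ f) d
    ∎
  where open ≡-Reasoning

clear-denominators : ∀ x y w u {D Q X Y W U} →
  x *ℚ D ≡ X → y *ℚ (Q *ℚ Q) ≡ Y → w *ℚ Q ≡ W → u *ℚ (D *ℚ (Q *ℚ Q)) ≡ U →
  (x -ℚ ((-ℚ y +ℚ w) +ℚ u)) *ℚ (D *ℚ (Q *ℚ Q)) ≡ X *ℚ (Q *ℚ Q) +ℚ Y *ℚ D -ℚ W *ℚ D *ℚ Q -ℚ U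
clear-denominators x y w u {D} {Q} refl refl refl refl = identity x y w u D Q
  where
  identity : ∀ x y w u D Q →
    (x -ℚ ((-ℚ y +ℚ w) +ℚ u)) *ℚ (D *ℚ (Q *ℚ Q))
      ≡ (x *ℚ D) *ℚ (Q *ℚ Q) +ℚ (y *ℚ (Q *ℚ Q)) *ℚ D -ℚ (w *ℚ Q) *ℚ D *ℚ Q -ℚ u *ℚ (D *ℚ (Q *ℚ Q))
  identity = RingSolver.solve-∀ ℚ-ring

term-difference-*-denominator : ∀ {d q} X Y W U → d ≢ 0ℤ → q ≢ 0ℤ →
  (frac X d -ℚ ((-ℚ frac Y (q * q) +ℚ frac W q) +ℚ frac U (d * (q * q)))) *ℚ fromℤ (d * (q * q))
    ≡ fromℤ (X * (q * q) + Y * d - W * d * q - U)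
term-difference-*-denominator {d} {q} X Y W U d≢0 q≢0 = begin
  D *ℚ fromℤ (d * (q * q))
    ≡⟨ cong (D *ℚ_) fromℤ-dqq ⟩
  D *ℚ (fromℤ d *ℚ (fromℤ q *ℚ fromℤ q))
    ≡⟨ clear-denominators (frac X d) (frac Y (q * q)) (frac W q) (frac U (d * (q * q)))
         (frac-cancelʳ X d≢0) (cancel Y fromℤ-qq q*q≢0)
         (frac-cancelʳ W q≢0) (cancel U fromℤ-dqq (*-≢0 d≢0 q*q≢0)) ⟩
  fromℤ X *ℚ (fromℤ q *ℚ fromℤ q) +ℚ fromℤ Y *ℚ fromℤ d -ℚ fromℤ W *ℚ fromℤ d *ℚ fromℤ q -ℚ fromℤ U
    ≡⟨ fromℤ-numerator ⟨
  fromℤ (X * (q * q) + Y * d - W * d * q - U)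
    ∎
  where
  open ≡-Reasoning
  D : ℚ
  D = frac X d -ℚ ((-ℚ frac Y (q * q) +ℚ frac W q) +ℚ frac U (d * (q * q)))
  q*q≢0 : q * q ≢ 0ℤ
  q*q≢0 = *-≢0 q≢0 q≢0
  fromℤ-qq : fromℤ (q * q) ≡ fromℤ q *ℚ fromℤ q
  fromℤ-qq = fromℤ-homo-* q q
  fromℤ-dqq : fromℤ (d * (q * q)) ≡ fromℤ d *ℚ (fromℤ q *ℚ fromℤ q)
  fromℤ-dqq = trans (fromℤ-homo-* d (q * q)) (cong (fromℤ d *ℚ_) fromℤ-qq)
  cancel : ∀ a {e r} → fromℤ e ≡ r → e ≢ 0ℤ → frac a e *ℚ r ≡ fromℤ a
  cancel a refl = frac-cancelʳ a
  fromℤ-numerator : fromℤ (X * (q * q) + Y * d - W * d * q - U)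
    ≡ fromℤ X *ℚ (fromℤ q *ℚ fromℤ q) +ℚ fromℤ Y *ℚ fromℤ d -ℚ fromℤ W *ℚ fromℤ d *ℚ fromℤ q -ℚ fromℤ U
  fromℤ-numerator
    rewrite fromℤ-homo-minus (X * (q * q) + Y * d - W * d * q) U
          | fromℤ-homo-minus (X * (q * q) + Y * d) (W * d * q)
          | fromℤ-homo-+ (X * (q * q)) (Y * d) | fromℤ-homo-* X (q * q) | fromℤ-qq
          | fromℤ-homo-* Y d | fromℤ-homo-* (W * d) q | fromℤ-homo-* W d = refl

frac-combination-≡mod1 : ∀ {d q} X Y W U → d ≢ 0ℤ → q ≢ 0ℤ →
  d * (q * q) ∣ₛ X * (q * q) + Y * d - W * d * q - U →
  frac X d ≡ℚ[mod1] ((-ℚ frac Y (q * q) +ℚ frac W q) +ℚ frac U (d * (q * q)))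
frac-combination-≡mod1 {d} X Y W U d≢0 q≢0 divisible =
  ≡mod1-by-clearing {frac X d} (*-≢0 d≢0 (*-≢0 q≢0 q≢0)) divisible
    (term-difference-*-denominator X Y W U d≢0 q≢0)

unit-cancelˡ-∣ : ∀ {n m w x} → n ∣ₛ m * w - 1ℤ → n ∣ₛ m * x → n ∣ₛ x
unit-cancelˡ-∣ {n} {m} {w} {x} n∣mw-1 n∣mx =
  subst (n ∣ₛ_) (identity m w x) (∣m∣n⇒∣m-n (∣n⇒∣m*n w n∣mx) (∣n⇒∣m*n x n∣mw-1))
  where
  identity : ∀ m w x → w * (m * x) - x * (m * w - 1ℤ) ≡ x
  identity = solve-∀

∣-*-of-unit : ∀ {n m w x} → n ∣ₛ m * w - 1ℤ → m ∣ₛ x → n ∣ₛ x → m * n ∣ₛ x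
∣-*-of-unit {n} {m} {w} n∣mw-1 (divides k refl) n∣km
  with unit-cancelˡ-∣ {m = m} {w} {k} n∣mw-1 (subst (n ∣ₛ_) (ℤP.*-comm k m) n∣km)
... | divides j refl = divides j (trans (ℤP.*-assoc j n m) (cong (j *_) (ℤP.*-comm n m)))

cross-ratio-mod : ∀ {q} u₁ v₁ u v a b →
  q ∣ₛ (+ 4) * v₁ * a - 1ℤ → q ∣ₛ (+ 4) * (v₁ * v₁) * b - 1ℤ → q ∣ₛ u₁ * v - u * v₁ →
  q ∣ₛ a * u - u₁ * b * v
cross-ratio-mod {q} u₁ v₁ u v a b q∣4v₁a-1 q∣4v₁²b-1 q∣u₁v-uv₁ =
  unit-cancelˡ-∣ {m = (+ 4) * (v₁ * v₁)} {b} q∣4v₁²b-1 (subst (q ∣ₛ_) (identity u₁ v₁ u v a b)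
    (∣m∣n⇒∣m-n (∣m∣n⇒∣m-n (∣n⇒∣m*n (v₁ * u) q∣4v₁a-1) (∣n⇒∣m*n (u₁ * v) q∣4v₁²b-1)) q∣u₁v-uv₁))
  where
  identity : ∀ u₁ v₁ u v a b →
    v₁ * u * ((+ 4) * v₁ * a - 1ℤ) - u₁ * v * ((+ 4) * (v₁ * v₁) * b - 1ℤ) - (u₁ * v - u * v₁)
      ≡ (+ 4) * (v₁ * v₁) * (a * u - u₁ * b * v)
  identity = solve-∀

module _ (q u₁ v₁ a b u v ℓ q̄ : ℤ) where

  private
    d : ℤ
    d = (+ 4) * v

  term-numerator : ℤ
  term-numerator = q̄ * q̄ * (u * u) * (q * q) + u₁ * a * u * d - u₁ * b * ℓ * d * q - u * u

  d∣term-numerator : d ∣ₛ q * q̄ - 1ℤ → d ∣ₛ term-numerator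
  d∣term-numerator d∣qq̄-1 = subst (d ∣ₛ_) (identity q u₁ a b u ℓ q̄ d)
    (∣m∣n⇒∣m+n (∣n⇒∣m*n (u * u * (q * q̄ + 1ℤ)) d∣qq̄-1) (divides (u₁ * a * u - u₁ * b * ℓ * q) refl))
    where
    identity : ∀ q u₁ a b u ℓ q̄ d →
      u * u * (q * q̄ + 1ℤ) * (q * q̄ - 1ℤ) + (u₁ * a * u - u₁ * b * ℓ * q) * d
        ≡ q̄ * q̄ * (u * u) * (q * q) + u₁ * a * u * d - u₁ * b * ℓ * d * q - u * u
    identity = solve-∀

  q²∣term-numerator : u₁ * v ≡ u * v₁ + q * ℓ → q * q ∣ₛ (+ 4) * v₁ * a - 1ℤ → q ∣ₛ a * u - u₁ * b * v →
    q * q ∣ₛ term-numerator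
  q²∣term-numerator cross q²∣4v₁a-1 q∣au-u₁bv = subst (q * q ∣ₛ_) (identity q u₁ v₁ a b u v ℓ q̄)
    (∣m∣n⇒∣m+n (∣m∣n⇒∣m+n (∣m∣n⇒∣m+n
      (divides (q̄ * q̄ * (u * u)) refl)
      (∣n⇒∣m*n (u * u) q²∣4v₁a-1))
      (*-monoˡ-∣ q (∣n⇒∣m*n ((+ 4) * ℓ) q∣au-u₁bv)))
      (∣n⇒∣m*n ((+ 4) * a * u) (divides 0ℤ (ℤP.i≡j⇒i-j≡0 cross))))
    where
    identity : ∀ q u₁ v₁ a b u v ℓ q̄ →
      q̄ * q̄ * (u * u) * (q * q) + u * u * ((+ 4) * v₁ * a - 1ℤ) + (+ 4) * ℓ * (a * u - u₁ * b * v) * q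
        + (+ 4) * a * u * (u₁ * v - (u * v₁ + q * ℓ))
        ≡ q̄ * q̄ * (u * u) * (q * q) + u₁ * a * u * ((+ 4) * v) - u₁ * b * ℓ * ((+ 4) * v) * q - u * u
    identity = solve-∀

  term-numerator-divisible : u₁ * v ≡ u * v₁ + q * ℓ → d ∣ₛ q * q̄ - 1ℤ →
    q * q ∣ₛ (+ 4) * v₁ * a - 1ℤ → q ∣ₛ (+ 4) * (v₁ * v₁) * b - 1ℤ → d * (q * q) ∣ₛ term-numerator
  term-numerator-divisible cross d∣qq̄-1 q²∣4v₁a-1 q∣4v₁²b-1 =
    subst (_∣ₛ term-numerator) (ℤP.*-comm (q * q) d)
      (∣-*-of-unit d∣q²q̄²-1 (q²∣term-numerator cross q²∣4v₁a-1 q∣au-u₁bv) (d∣term-numerator d∣qq̄-1))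
    where
    square-identity : ∀ q q̄ → (q * q̄ + 1ℤ) * (q * q̄ - 1ℤ) ≡ q * q * (q̄ * q̄) - 1ℤ
    square-identity = solve-∀
    d∣q²q̄²-1 : d ∣ₛ q * q * (q̄ * q̄) - 1ℤ
    d∣q²q̄²-1 = subst (d ∣ₛ_) (square-identity q q̄) (∣n⇒∣m*n (q * q̄ + 1ℤ) d∣qq̄-1)
    cancel-identity : ∀ x y q → (x + q * y) - x ≡ y * q
    cancel-identity = solve-∀
    q∣u₁v-uv₁ : q ∣ₛ u₁ * v - u * v₁
    q∣u₁v-uv₁ = divides ℓ (trans (cong (_- u * v₁) cross) (cancel-identity (u * v₁) ℓ q))
    q∣au-u₁bv : q ∣ₛ a * u - u₁ * b * v
    q∣au-u₁bv = cross-ratio-mod u₁ v₁ u v a b (∣-trans (divides q refl) q²∣4v₁a-1) q∣4v₁²b-1 q∣u₁v-uv₁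

  term-≡mod1 : q ≢ 0ℤ → v ≢ 0ℤ → u₁ * v ≡ u * v₁ + q * ℓ → d ∣ q * q̄ - 1ℤ →
    q * q ∣ (+ 4) * v₁ * a - 1ℤ → q ∣ (+ 4) * (v₁ * v₁) * b - 1ℤ →
    frac (q̄ * q̄ * (u * u)) d
      ≡ℚ[mod1] ((-ℚ frac (u₁ * a * u) (q * q) +ℚ frac (u₁ * b * ℓ) q) +ℚ frac (u * u) (d * (q * q)))
  term-≡mod1 q≢0 v≢0 cross d∣qq̄-1 q²∣4v₁a-1 q∣4v₁²b-1 =
    frac-combination-≡mod1 (q̄ * q̄ * (u * u)) (u₁ * a * u) (u₁ * b * ℓ) (u * u) d≢0 q≢0
      (term-numerator-divisible cross (∣ᵤ⇒∣ d∣qq̄-1) (∣ᵤ⇒∣ q²∣4v₁a-1) (∣ᵤ⇒∣ q∣4v₁²b-1))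
    where
    d≢0 : d ≢ 0ℤ
    d≢0 = *-≢0 {+ 4} (λ ()) v≢0

sumℚ-right-sides : ∀ {n} c₁ c₂ (u ℓ : Fin n → ℤ) (e : Fin n → ℚ) d₁ d₂ →
  sumℚ (λ i → (-ℚ frac (c₁ * u i) d₁ +ℚ frac (c₂ * ℓ i) d₂) +ℚ e i)
    ≡ (-ℚ frac (c₁ * sumℤ u) d₁ +ℚ frac (c₂ * sumℤ ℓ) d₂) +ℚ sumℚ e
sumℚ-right-sides {n} c₁ c₂ u ℓ e d₁ d₂ = begin
  sumℚ (λ i → (-ℚ f i +ℚ g i) +ℚ e i)         ≡⟨ sumℚ-+ (λ i → -ℚ f i +ℚ g i) e ⟩
  sumℚ (λ i → -ℚ f i +ℚ g i) +ℚ sumℚ e        ≡⟨ cong (_+ℚ sumℚ e) (sumℚ-+ (λ i → -ℚ f i) g) ⟩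
  (sumℚ (λ i → -ℚ f i) +ℚ sumℚ g) +ℚ sumℚ e   ≡⟨ cong (λ t → (t +ℚ sumℚ g) +ℚ sumℚ e) (sumℚ-neg f) ⟩
  (-ℚ sumℚ f +ℚ sumℚ g) +ℚ sumℚ e
    ≡⟨ cong₂ (λ s t → (-ℚ s +ℚ t) +ℚ sumℚ e) (sumℚ-frac c₁ u d₁) (sumℚ-frac c₂ ℓ d₂) ⟩
  (-ℚ frac (c₁ * sumℤ u) d₁ +ℚ frac (c₂ * sumℤ ℓ) d₂) +ℚ sumℚ e ∎
  where
  open ≡-Reasoning
  f g : Fin n → ℚ
  f i = frac (c₁ * u i) d₁
  g i = frac (c₂ * ℓ i) d₂

lemma5p1 : (q : ℤ) → q ≢ 0ℤ → ¬ ((+ 2) ∣ q) →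
    (k : ℕ) → (u v ℓ : Fin (ℕ.suc k) → ℤ) →
    (∀ i → v i ≢ 0ℤ) →
    (∀ i → u zero * v i ≡ u i * v zero + q * ℓ i) →
    (∀ i → gcd ((+ 4) * u i * v i) q ≡ 1ℤ) →
    (qbar : Fin (ℕ.suc k) → ℤ) → (∀ i → ((+ 4) * v i) ∣ (q * qbar i - 1ℤ)) →
    (a : ℤ) → (q * q) ∣ ((+ 4) * v zero * a - 1ℤ) →
    (b : ℤ) → q ∣ ((+ 4) * (v zero * v zero) * b - 1ℤ) →
    sumℚ (λ i → frac (qbar i * qbar i * (u i * u i)) ((+ 4) * v i))
      ≡ℚ[mod1]
    ((-ℚ frac (u zero * a * sumℤ u) (q * q)
      +ℚ frac (u zero * b * sumℤ ℓ) q)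
      +ℚ sumℚ (λ i → frac (u i * u i) ((+ 4) * v i * (q * q))))
lemma5p1 q q≢0 _ k u v ℓ v≢0 cross _ qbar qbar-inv a a-inv b b-inv =
  subst (sumℚ lhs ≡ℚ[mod1]_) (sumℚ-right-sides (u zero * a) (u zero * b) u ℓ correction (q * q) q)
    (sumℚ-cong-mod1 lhs rhs λ i →
      term-≡mod1 q (u zero) (v zero) a b (u i) (v i) (ℓ i) (qbar i)
        q≢0 (v≢0 i) (cross i) (qbar-inv i) a-inv b-inv)
  where
  lhs rhs correction : Fin (ℕ.suc k) → ℚ
  lhs i        = frac (qbar i * qbar i * (u i * u i)) ((+ 4) * v i)
  correction i = frac (u i * u i) ((+ 4) * v i * (q * q))
  rhs i        = (-ℚ frac (u zero * a * u i) (q * q) +ℚ frac (u zero * b * ℓ i) q) +ℚ correction i
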